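{- Let $n\geq 1$ be an integer and let $A$ be an irreducible $k\times k$ matrix with entries in $\mathbb{Z}_{\geq 0}$. Then the following are equivalent: (i) $A^2 - nA = 0$; (ii) $A$ has rank $1$, trace $n$, and there exist $v, w \in \mathbb{Z}_{>0}^k$ such that $A = vw^t$; (iii) $A^2 - nA = 0$ and $A$ is positive (all entries of $A$ are $>0$).
   Context: A non-negative $k\times k$ matrix $A$ is irreducible if for every pair $i,j$ there exists $m\geq 1$ such that the $(i,j)$ entry of $A^m$ is positive. Vectors in $\mathbb{Z}^k$ are column vectors and $w^t$ denotes the transpose. -}

module Defs where

open import Data.Nat using (ℕ; zero; suc)
open import Data.Fin using (Fin) renaming (zero to fzero; suc to fsuc)
open import Data.Integer using (ℤ; +_; _+_; _*_; _-_; _≤_; _<_)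
open import Data.Product using (Σ; ∃; ∃-syntax; _×_)
open import Relation.Binary.PropositionalEquality using (_≡_)
open import Relation.Nullary using (¬_)
open import Function.Definitions using (Injective)

-- Square integer matrices, indexed as A i j (row i, column j).
Mat : ℕ → Set
Mat k = Fin k → Fin k → ℤ

sumℤ : ∀ {k} → (Fin k → ℤ) → ℤ
sumℤ {zero}  f = + 0
sumℤ {suc k} f = f fzero + sumℤ (λ j → f (fsuc j))

_⊗_ : ∀ {k} → Mat k → Mat k → Mat k
(A ⊗ B) i j = sumℤ (λ l → A i l * B l j)

_^ᴹ_ : ∀ {k} → Mat k → ℕ → Mat k
_^ᴹ_ {k} A zero    i j = Id i j
  where
  open import Data.Fin using (_≟_)
  open import Relation.Nullary using (yes; no)
  Id : Mat k
  Id i j with i ≟ j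
  ... | yes _ = + 1
  ... | no  _ = + 0
(A ^ᴹ suc m) = A ⊗ (A ^ᴹ m)

trace : ∀ {k} → Mat k → ℤ
trace A = sumℤ (λ i → A i i)

NonNegative : ∀ {k} → Mat k → Set
NonNegative A = ∀ i j → + 0 ≤ A i j

Positive : ∀ {k} → Mat k → Set
Positive A = ∀ i j → + 0 < A i j

Irreducible : ∀ {k} → Mat k → Set
Irreducible A = ∀ i j → ∃[ m ] (+ 0 < (A ^ᴹ suc m) i j)

-- A family of r vectors in ℤ^k is linearly independent (over ℤ, equivalently over ℚ).
LinIndep : ∀ {k r} → (Fin r → Fin k → ℤ) → Set
LinIndep {k} {r} vs =
  (c : Fin r → ℤ) → (∀ i → sumℤ (λ j → c j * vs j i) ≡ + 0) → ∀ j → c j ≡ + 0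

col : ∀ {k} → Mat k → Fin k → Fin k → ℤ
col A j i = A i j

HasRank : ∀ {k} → Mat k → ℕ → Set
HasRank {k} A r =
  (Σ (Fin r → Fin k) λ f → Injective _≡_ _≡_ f × LinIndep (λ a → col A (f a)))
  × (∀ (f : Fin (suc r) → Fin k) → ¬ LinIndep (λ a → col A (f a)))

QuadRel : ∀ {k} → ℕ → Mat k → Set
QuadRel n A = ∀ i j → (A ^ᴹ 2) i j - (+ n) * A i j ≡ + 0

OuterProd : ∀ {k} → Mat k → (Fin k → ℤ) → (Fin k → ℤ) → Set
OuterProd A v w = ∀ i j → A i j ≡ v i * w j

Cond-i : ∀ {k} → ℕ → Mat k → Set
Cond-i n A = QuadRel n A

Cond-ii : ∀ {k} → ℕ → Mat k → Set
Cond-ii {k} n A = HasRank A 1 × trace A ≡ + n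
  × Σ (Fin k → ℤ) λ v → Σ (Fin k → ℤ) λ w →
      (∀ i → + 0 < v i) × (∀ i → + 0 < w i) × OuterProd A v w

Cond-iii : ∀ {k} → ℕ → Mat k → Set
Cond-iii n A = QuadRel n A × Positive A

-- From A ⊗ A = n A one gets A^(m+1) = n^m A, so irreducibility makes A positive.
-- Every column of A is then an eigenvector of the positive matrix A for the
-- eigenvalue n, and a minimal-ratio argument shows that any two such eigenvectors
-- are proportional when one of them is positive: if x_p/u_p is minimal, then
-- u_p x − x_p u is a nonnegative eigenvector vanishing at p, hence zero.  Dividing
-- the first column by the gcd g of its entries gives a primitive vector v, and a
-- Bézout combination c·v = 1 recovers the integer row w with A = v wᵗ.  For an
-- outer product A ⊗ A = trace A · A, which pins the trace down to n.
module Submission where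

open import Defs
open import Data.Nat using (ℕ; zero; suc; _≥_; z≤n; s≤s)
import Data.Nat as ℕ
import Data.Nat.Properties as ℕ
open import Data.Nat.Divisibility using (_∣_; ∣-trans; quotient; m∣n⇒n≡quotient*m)
open import Data.Nat.GCD using (gcd; gcd-GCD; gcd[m,n]∣m; gcd[m,n]∣n; module Bézout)
open import Data.Fin using (Fin; _≟_) renaming (zero to fzero; suc to fsuc)
open import Data.Fin.Properties using (suc-injective)
open import Data.Integer using (ℤ; +_; +[1+_]; _+_; _*_; _-_; -_; _^_; _≤_; _<_; +≤+; +<+; ∣_∣)
open import Data.Integer.Base using (>-nonZero; ≢-nonZero; nonNegative)
import Data.Integer.Properties as ℤ
open import Data.Integer.Tactic.RingSolver using (solve-∀)
open import Data.Rational.Unnormalised.Base using (ℚᵘ; mkℚᵘ)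
import Data.Rational.Unnormalised.Properties as ℚᵘ
open import Data.List using (allFin)
import Data.List.Relation.Unary.All as All
open import Data.List.Membership.Propositional.Properties using (∈-allFin)
open import Data.List.Extrema ℚᵘ.≤-totalOrder using (argmin; f[argmin]≤f[xs])
open import Data.Product using (Σ; _×_; ∃-syntax; ∃₂; _,_; proj₁; proj₂)
open import Data.Sum using (inj₁; inj₂)
open import Function.Definitions using (Injective)
open import Function using (_∘_)
open import Function.Bundles using (_⇔_; mk⇔; module Equivalence)
open import Relation.Nullary using (yes; no; ¬_; contradiction)
open import Relation.Binary.PropositionalEquality
open import Algebra.Properties.CommutativeSemigroup ℤ.*-commutativeSemigroup
  using (x∙yz≈y∙xz; x∙yz≈y∙zx; xy∙z≈xz∙y)
open ≡-Reasoning

private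
  variable
    k : ℕ

-- Finite sums

sumℤ-cong : {f g : Fin k → ℤ} → (∀ i → f i ≡ g i) → sumℤ f ≡ sumℤ g
sumℤ-cong {zero}  eq = refl
sumℤ-cong {suc k} eq = cong₂ _+_ (eq fzero) (sumℤ-cong (eq ∘ fsuc))

sumℤ-zero : sumℤ {k} (λ _ → + 0) ≡ + 0
sumℤ-zero {zero}  = refl
sumℤ-zero {suc k} = trans (ℤ.+-identityˡ _) (sumℤ-zero {k})

*-distribˡ-sumℤ : ∀ c (f : Fin k → ℤ) → c * sumℤ f ≡ sumℤ (λ i → c * f i)
*-distribˡ-sumℤ {zero}  c f = ℤ.*-zeroʳ c
*-distribˡ-sumℤ {suc k} c f =
  trans (ℤ.*-distribˡ-+ c _ _) (cong (_+_ (c * f fzero)) (*-distribˡ-sumℤ c (f ∘ fsuc)))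

sumℤ-linear : ∀ a b (f g : Fin k → ℤ) →
  sumℤ (λ i → a * f i - b * g i) ≡ a * sumℤ f - b * sumℤ g
sumℤ-linear {zero}  a b f g = sym (cong₂ _-_ (ℤ.*-zeroʳ a) (ℤ.*-zeroʳ b))
sumℤ-linear {suc k} a b f g =
  trans (cong (_+_ (a * f fzero - b * g fzero)) (sumℤ-linear a b (f ∘ fsuc) (g ∘ fsuc)))
        (regroup a b (f fzero) (g fzero) _ _)
  where
  regroup : ∀ a b x y s t → (a * x - b * y) + (a * s - b * t) ≡ a * (x + s) - b * (y + t)
  regroup = solve-∀

sumℤ-nonNeg : {f : Fin k → ℤ} → (∀ i → + 0 ≤ f i) → + 0 ≤ sumℤ f
sumℤ-nonNeg {zero}  _  = +≤+ z≤n
sumℤ-nonNeg {suc k} nn = ℤ.+-mono-≤ (nn fzero) (sumℤ-nonNeg (nn ∘ fsuc))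

nonNeg-+-≡0 : {a b : ℤ} → + 0 ≤ a → + 0 ≤ b → a + b ≡ + 0 → a ≡ + 0 × b ≡ + 0
nonNeg-+-≡0 {+ m} {+ n} _ _ eq =
  cong +_ (ℕ.m+n≡0⇒m≡0 m (ℤ.+-injective eq)) , cong +_ (ℕ.m+n≡0⇒n≡0 m (ℤ.+-injective eq))

sumℤ-nonNeg-≡0 : {f : Fin k → ℤ} → (∀ i → + 0 ≤ f i) → sumℤ f ≡ + 0 → ∀ i → f i ≡ + 0
sumℤ-nonNeg-≡0 {suc k} nn eq fzero    = proj₁ (nonNeg-+-≡0 (nn fzero) (sumℤ-nonNeg (nn ∘ fsuc)) eq)
sumℤ-nonNeg-≡0 {suc k} nn eq (fsuc i) =
  sumℤ-nonNeg-≡0 (nn ∘ fsuc) (proj₂ (nonNeg-+-≡0 (nn fzero) (sumℤ-nonNeg (nn ∘ fsuc)) eq)) i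

sumℤ-select : (f e : Fin k → ℤ) (j : Fin k) → e j ≡ + 1 → (∀ l → l ≢ j → e l ≡ + 0) →
  sumℤ (λ l → f l * e l) ≡ f j
sumℤ-select {suc k} f e fzero e₁ e₀ = begin
  f fzero * e fzero + sumℤ (λ l → f (fsuc l) * e (fsuc l))
    ≡⟨ cong₂ _+_ (cong (f fzero *_) e₁)
                 (sumℤ-cong (λ l → trans (cong (f (fsuc l) *_) (e₀ (fsuc l) λ ())) (ℤ.*-zeroʳ (f (fsuc l))))) ⟩
  f fzero * + 1 + sumℤ {k} (λ _ → + 0)
    ≡⟨ cong₂ _+_ (ℤ.*-identityʳ (f fzero)) (sumℤ-zero {k}) ⟩
  f fzero + + 0
    ≡⟨ ℤ.+-identityʳ _ ⟩
  f fzero ∎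
sumℤ-select {suc k} f e (fsuc j) e₁ e₀ = begin
  f fzero * e fzero + rest  ≡⟨ cong (λ t → f fzero * t + rest) (e₀ fzero λ ()) ⟩
  f fzero * + 0 + rest      ≡⟨ cong (_+ rest) (ℤ.*-zeroʳ (f fzero)) ⟩
  + 0 + rest                ≡⟨ ℤ.+-identityˡ rest ⟩
  rest                      ≡⟨ sumℤ-select (f ∘ fsuc) (e ∘ fsuc) j e₁ e₀-tail ⟩
  f (fsuc j)                ∎
  where
  rest : ℤ
  rest = sumℤ (λ l → f (fsuc l) * e (fsuc l))
  e₀-tail : ∀ l → l ≢ j → e (fsuc l) ≡ + 0
  e₀-tail l l≢j = e₀ (fsuc l) (l≢j ∘ suc-injective)

-- Matrices whose square is a multiple of themselves

^ᴹ-zero-diagonal : (A : Mat k) (j : Fin k) → (A ^ᴹ 0) j j ≡ + 1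
^ᴹ-zero-diagonal A j with j ≟ j
... | yes _  = refl
... | no j≢j = contradiction refl j≢j

^ᴹ-zero-offDiagonal : (A : Mat k) {i j : Fin k} → i ≢ j → (A ^ᴹ 0) i j ≡ + 0
^ᴹ-zero-offDiagonal A {i} {j} i≢j with i ≟ j
... | yes i≡j = contradiction i≡j i≢j
... | no _    = refl

⊗-identityʳ : (A B : Mat k) → ∀ i j → (A ⊗ (B ^ᴹ 0)) i j ≡ A i j
⊗-identityʳ A B i j =
  sumℤ-select (A i) (λ l → (B ^ᴹ 0) l j) j (^ᴹ-zero-diagonal B j) (λ l → ^ᴹ-zero-offDiagonal B)

^ᴹ-two : (A : Mat k) → ∀ i j → (A ^ᴹ 2) i j ≡ (A ⊗ A) i j
^ᴹ-two A i j = sumℤ-cong (λ l → cong (A i l *_) (⊗-identityʳ A A l j))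

SquareIs : ℤ → Mat k → Set
SquareIs c A = ∀ i j → (A ⊗ A) i j ≡ c * A i j

quadRel⇔squareIs : (n : ℕ) (A : Mat k) → QuadRel n A ⇔ SquareIs (+ n) A
quadRel⇔squareIs n A = mk⇔
  (λ q i j → ℤ.i-j≡0⇒i≡j _ _ (trans (cong (_- + n * A i j) (sym (^ᴹ-two A i j))) (q i j)))
  (λ s i j → trans (cong (_- + n * A i j) (^ᴹ-two A i j)) (ℤ.i≡j⇒i-j≡0 (s i j)))

squareIs⇒^ᴹ : {c : ℤ} {A : Mat k} → SquareIs c A → ∀ m i j → (A ^ᴹ suc m) i j ≡ c ^ m * A i j
squareIs⇒^ᴹ {A = A} sq zero i j = trans (⊗-identityʳ A A i j) (sym (ℤ.*-identityˡ (A i j)))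
squareIs⇒^ᴹ {c = c} {A} sq (suc m) i j = begin
  sumℤ (λ l → A i l * (A ^ᴹ suc m) l j)
    ≡⟨ sumℤ-cong (λ l → trans (cong (A i l *_) (squareIs⇒^ᴹ sq m l j)) (x∙yz≈y∙xz (A i l) (c ^ m) (A l j))) ⟩
  sumℤ (λ l → c ^ m * (A i l * A l j))
    ≡⟨ sym (*-distribˡ-sumℤ (c ^ m) (λ l → A i l * A l j)) ⟩
  c ^ m * (A ⊗ A) i j
    ≡⟨ cong (c ^ m *_) (sq i j) ⟩
  c ^ m * (c * A i j)
    ≡⟨ x∙yz≈y∙xz (c ^ m) c (A i j) ⟩
  c * (c ^ m * A i j)
    ≡⟨ sym (ℤ.*-assoc c (c ^ m) (A i j)) ⟩
  c ^ suc m * A i j ∎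

0≤j∧0<i*j⇒0<j : ∀ i {j} → + 0 ≤ j → + 0 < i * j → + 0 < j
0≤j∧0<i*j⇒0<j i {+ zero}   _ 0<i*0 = contradiction (subst (+ 0 <_) (ℤ.*-zeroʳ i) 0<i*0) (ℤ.<-irrefl refl)
0≤j∧0<i*j⇒0<j i {+[1+ j ]} _ _     = +<+ (s≤s z≤n)

squareIs∧irreducible⇒positive : {c : ℤ} {A : Mat k} →
  SquareIs c A → NonNegative A → Irreducible A → Positive A
squareIs∧irreducible⇒positive {c = c} sq nonNeg irr i j with irr i j
... | m , 0<Aᵐ⁺¹ = 0≤j∧0<i*j⇒0<j (c ^ m) (nonNeg i j) (subst (+ 0 <_) (squareIs⇒^ᴹ sq m i j) 0<Aᵐ⁺¹)

-- Eigenvectors of positive matrices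

Eigenvector : ℤ → Mat k → (Fin k → ℤ) → Set
Eigenvector c A x = ∀ i → sumℤ (λ l → A i l * x l) ≡ c * x i

squareIs⇒eigenvector-col : {c : ℤ} {A : Mat k} → SquareIs c A → ∀ j → Eigenvector c A (col A j)
squareIs⇒eigenvector-col sq j i = sq i j

eigenvector-linear : {c : ℤ} {A : Mat k} {x y : Fin k → ℤ} →
  Eigenvector c A x → Eigenvector c A y → ∀ a b → Eigenvector c A (λ i → a * x i - b * y i)
eigenvector-linear {c = c} {A} {x} {y} ex ey a b i = begin
  sumℤ (λ l → A i l * (a * x l - b * y l))
    ≡⟨ sumℤ-cong (λ l → distribute (A i l) a b (x l) (y l)) ⟩
  sumℤ (λ l → a * (A i l * x l) - b * (A i l * y l))
    ≡⟨ sumℤ-linear a b (λ l → A i l * x l) (λ l → A i l * y l) ⟩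
  a * sumℤ (λ l → A i l * x l) - b * sumℤ (λ l → A i l * y l)
    ≡⟨ cong₂ (λ s t → a * s - b * t) (ex i) (ey i) ⟩
  a * (c * x i) - b * (c * y i)
    ≡⟨ sym (distribute c a b (x i) (y i)) ⟩
  c * (a * x i - b * y i) ∎
  where
  distribute : ∀ m a b x y → m * (a * x - b * y) ≡ a * (m * x) - b * (m * y)
  distribute = solve-∀

*-cancelˡ-≡-pos : ∀ {a x y} → + 0 < a → a * x ≡ a * y → x ≡ y
*-cancelˡ-≡-pos {a} {x} {y} 0<a = ℤ.*-cancelˡ-≡ a x y {{>-nonZero 0<a}}

nonNeg-eigenvector-vanishing : {c : ℤ} {A : Mat k} {y : Fin k → ℤ} (p : Fin k) →
  Eigenvector c A y → (∀ l → + 0 < A p l) → (∀ l → + 0 ≤ y l) → y p ≡ + 0 → ∀ l → y l ≡ + 0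
nonNeg-eigenvector-vanishing {c = c} {A} {y} p ey rowPos nonNeg yₚ≡0 l =
  *-cancelˡ-≡-pos (rowPos l) (trans (terms-vanish l) (sym (ℤ.*-zeroʳ (A p l))))
  where
  terms-vanish : ∀ l → A p l * y l ≡ + 0
  terms-vanish = sumℤ-nonNeg-≡0
    (λ l → ℤ.*-monoʳ-≤-nonNeg (y l) {{nonNegative (nonNeg l)}} (ℤ.<⇒≤ (rowPos l)))
    (trans (ey p) (trans (cong (c *_) yₚ≡0) (ℤ.*-zeroʳ c)))

ratio-minimiser : (x u : Fin (suc k) → ℤ) → (∀ i → + 0 < u i) → ∃[ p ] ∀ i → x p * u i ≤ x i * u p
ratio-minimiser {k} x u 0<u = p , λ i →
  subst₂ _≤_ (cong (x p *_) (denominator i)) (cong (x i *_) (denominator p))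
    (ℚᵘ.drop-*≤* (All.lookup (f[argmin]≤f[xs] {f = ratio} fzero (allFin (suc k))) (∈-allFin i)))
  where
  ratio : Fin (suc k) → ℚᵘ
  ratio i = mkℚᵘ (x i) (ℕ.pred ∣ u i ∣)
  p : Fin (suc k)
  p = argmin ratio fzero (allFin (suc k))
  denominator : ∀ i → + suc (ℕ.pred ∣ u i ∣) ≡ u i
  denominator i with u i | 0<u i
  ... | +[1+ _ ] | _        = refl
  ... | + 0      | +<+ ()

eigenvectors-proportional : {c : ℤ} {A : Mat (suc k)} {x u : Fin (suc k) → ℤ} →
  Positive A → Eigenvector c A x → Eigenvector c A u → (∀ i → + 0 < u i) →
  ∀ i l → x i * u l ≡ x l * u i
eigenvectors-proportional {k} {c} {A} {x} {u} pos ex eu 0<u i l = *-cancelˡ-≡-pos (0<u p) (begin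
  u p * (x i * u l)  ≡⟨ sym (ℤ.*-assoc (u p) (x i) (u l)) ⟩
  (u p * x i) * u l  ≡⟨ cong (_* u l) (ratio-constant i) ⟩
  (x p * u i) * u l  ≡⟨ xy∙z≈xz∙y (x p) (u i) (u l) ⟩
  (x p * u l) * u i  ≡⟨ cong (_* u i) (sym (ratio-constant l)) ⟩
  (u p * x l) * u i  ≡⟨ ℤ.*-assoc (u p) (x l) (u i) ⟩
  u p * (x l * u i)  ∎)
  where
  p : Fin (suc k)
  p = proj₁ (ratio-minimiser x u 0<u)
  minimal : ∀ l → x p * u l ≤ x l * u p
  minimal = proj₂ (ratio-minimiser x u 0<u)
  y : Fin (suc k) → ℤ
  y l = u p * x l - x p * u l
  y-nonNeg : ∀ l → + 0 ≤ y l
  y-nonNeg l = ℤ.i≤j⇒0≤j-i (subst (x p * u l ≤_) (ℤ.*-comm (x l) (u p)) (minimal l))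
  yₚ≡0 : y p ≡ + 0
  yₚ≡0 = ℤ.i≡j⇒i-j≡0 (ℤ.*-comm (u p) (x p))
  y-eigenvector : Eigenvector c A y
  y-eigenvector = eigenvector-linear {c = c} {A} {x} {u} ex eu (u p) (x p)
  ratio-constant : ∀ l → u p * x l ≡ x p * u l
  ratio-constant l = ℤ.i-j≡0⇒i≡j (u p * x l) (x p * u l)
    (nonNeg-eigenvector-vanishing {c = c} {A} {y} p y-eigenvector (pos p) y-nonNeg yₚ≡0 l)

-- Primitive integer vectors

am-bn≡d : ∀ {d} a m b n → d ℕ.+ b ℕ.* n ≡ a ℕ.* m → + a * + m - + b * + n ≡ + d
am-bn≡d {d} a m b n eq = begin
  + a * + m - + b * + n            ≡⟨ cong (_- + b * + n) (sym cast) ⟩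
  (+ d + + b * + n) - + b * + n    ≡⟨ cancel (+ d) (+ b * + n) ⟩
  + d                              ∎
  where
  cast : + d + + b * + n ≡ + a * + m
  cast = begin
    + d + + b * + n      ≡⟨ cong (_+_ (+ d)) (sym (ℤ.pos-* b n)) ⟩
    + d + + (b ℕ.* n)    ≡⟨ sym (ℤ.pos-+ d (b ℕ.* n)) ⟩
    + (d ℕ.+ b ℕ.* n)    ≡⟨ cong +_ eq ⟩
    + (a ℕ.* m)          ≡⟨ ℤ.pos-* a m ⟩
    + a * + m            ∎
  cancel : ∀ x y → (x + y) - y ≡ x
  cancel = solve-∀

bézout-combination : ∀ {d m n} → Bézout.Identity d m n → ∃₂ λ s t → s * + m + t * + n ≡ + d
bézout-combination {m = m} {n} (Bézout.+- x y eq) =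
  + x , - + y , trans (cong (_+_ (+ x * + m)) (sym (ℤ.neg-distribˡ-* (+ y) (+ n)))) (am-bn≡d x m y n eq)
bézout-combination {m = m} {n} (Bézout.-+ x y eq) =
  - + x , + y , trans (ℤ.+-comm (- + x * + m) (+ y * + n))
                      (trans (cong (_+_ (+ y * + n)) (sym (ℤ.neg-distribˡ-* (+ x) (+ m)))) (am-bn≡d y n x m eq))

gcd-combination : (x : Fin k → ℕ) →
  Σ ℕ λ g → (∀ i → g ∣ x i) × Σ (Fin k → ℤ) λ c → sumℤ (λ i → c i * + x i) ≡ + g
gcd-combination {zero}  x = 0 , (λ ()) , (λ ()) , refl
gcd-combination {suc k} x with gcd-combination (x ∘ fsuc)
... | g , g∣x , c , Σcx≡g with bézout-combination (Bézout.identity (gcd-GCD (x fzero) g))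
... | s , t , sx₀+tg≡d = gcd (x fzero) g , d∣x , coefficient , (begin
  s * + x fzero + sumℤ (λ i → (t * c i) * + x (fsuc i))
    ≡⟨ cong (_+_ (s * + x fzero)) (trans (sumℤ-cong (λ i → ℤ.*-assoc t (c i) (+ x (fsuc i))))
                                         (sym (*-distribˡ-sumℤ t (λ i → c i * + x (fsuc i))))) ⟩
  s * + x fzero + t * sumℤ (λ i → c i * + x (fsuc i))
    ≡⟨ cong (λ σ → s * + x fzero + t * σ) Σcx≡g ⟩
  s * + x fzero + t * + g
    ≡⟨ sx₀+tg≡d ⟩
  + gcd (x fzero) g ∎)
  where
  d∣x : ∀ i → gcd (x fzero) g ∣ x i
  d∣x fzero    = gcd[m,n]∣m (x fzero) g
  d∣x (fsuc i) = ∣-trans (gcd[m,n]∣n (x fzero) g) (g∣x i)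
  coefficient : Fin (suc k) → ℤ
  coefficient fzero    = s
  coefficient (fsuc i) = t * c i

Primitive : (Fin k → ℤ) → Set
Primitive {k} v = Σ (Fin k → ℤ) λ c → sumℤ (λ i → c i * v i) ≡ + 1

positive⇒multiple-of-primitive : (u : Fin (suc k) → ℤ) → (∀ i → + 0 < u i) →
  Σ ℤ λ g → + 0 < g × Σ (Fin (suc k) → ℤ) λ v → (∀ i → u i ≡ v i * g) × Primitive v
positive⇒multiple-of-primitive {k} u 0<u with gcd-combination (∣_∣ ∘ u)
... | g , g∣u , c , Σc∣u∣≡g = + g , 0<g , v , u≡vg , c , *-cancelˡ-≡-pos 0<g (begin
  + g * sumℤ (λ i → c i * v i)       ≡⟨ *-distribˡ-sumℤ (+ g) (λ i → c i * v i) ⟩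
  sumℤ (λ i → + g * (c i * v i))     ≡⟨ sumℤ-cong (λ i → x∙yz≈y∙zx (+ g) (c i) (v i)) ⟩
  sumℤ (λ i → c i * (v i * + g))     ≡⟨ sumℤ-cong (λ i → cong (c i *_) (sym (∣u∣≡vg i))) ⟩
  sumℤ (λ i → c i * + ∣ u i ∣)       ≡⟨ Σc∣u∣≡g ⟩
  + g                                ≡⟨ sym (ℤ.*-identityʳ (+ g)) ⟩
  + g * + 1                          ∎)
  where
  v : Fin (suc k) → ℤ
  v i = + quotient (g∣u i)
  ∣u∣≡vg : ∀ i → + ∣ u i ∣ ≡ v i * + g
  ∣u∣≡vg i = trans (cong +_ (m∣n⇒n≡quotient*m (g∣u i))) (ℤ.pos-* (quotient (g∣u i)) g)
  u≡vg : ∀ i → u i ≡ v i * + g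
  u≡vg i = trans (sym (ℤ.0≤i⇒+∣i∣≡i (ℤ.<⇒≤ (0<u i)))) (∣u∣≡vg i)
  0<g : + 0 < + g
  0<g = 0≤j∧0<i*j⇒0<j (v fzero) (+≤+ z≤n) (subst (+ 0 <_) (u≡vg fzero) (0<u fzero))

-- Outer products

proportional-columns⇒outerProd : (A : Mat k) (v c : Fin k → ℤ) →
  (∀ i l j → A i j * v l ≡ A l j * v i) → sumℤ (λ i → c i * v i) ≡ + 1 →
  OuterProd A v (λ j → sumℤ (λ i → c i * A i j))
proportional-columns⇒outerProd A v c proportional Σcv≡1 l j = sym (begin
  v l * sumℤ (λ i → c i * A i j)    ≡⟨ *-distribˡ-sumℤ (v l) (λ i → c i * A i j) ⟩
  sumℤ (λ i → v l * (c i * A i j))  ≡⟨ sumℤ-cong regroup ⟩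
  sumℤ (λ i → A l j * (c i * v i))  ≡⟨ sym (*-distribˡ-sumℤ (A l j) (λ i → c i * v i)) ⟩
  A l j * sumℤ (λ i → c i * v i)    ≡⟨ cong (A l j *_) Σcv≡1 ⟩
  A l j * + 1                       ≡⟨ ℤ.*-identityʳ (A l j) ⟩
  A l j                             ∎)
  where
  regroup : ∀ i → v l * (c i * A i j) ≡ A l j * (c i * v i)
  regroup i = begin
    v l * (c i * A i j)  ≡⟨ x∙yz≈y∙zx (v l) (c i) (A i j) ⟩
    c i * (A i j * v l)  ≡⟨ cong (c i *_) (proportional i l j) ⟩
    c i * (A l j * v i)  ≡⟨ x∙yz≈y∙xz (c i) (A l j) (v i) ⟩
    A l j * (c i * v i)  ∎

outerProd⇒squareIs-trace : {A : Mat k} {v w : Fin k → ℤ} → OuterProd A v w → SquareIs (trace A) A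
outerProd⇒squareIs-trace {A = A} {v} {w} op i j = begin
  sumℤ (λ l → A i l * A l j)  ≡⟨ sumℤ-cong entry ⟩
  sumℤ (λ l → A i j * A l l)  ≡⟨ sym (*-distribˡ-sumℤ (A i j) (λ l → A l l)) ⟩
  A i j * trace A             ≡⟨ ℤ.*-comm (A i j) (trace A) ⟩
  trace A * A i j             ∎
  where
  swap : ∀ a b c d → (a * b) * (c * d) ≡ (a * d) * (c * b)
  swap = solve-∀
  entry : ∀ l → A i l * A l j ≡ A i j * A l l
  entry l = begin
    A i l * A l j              ≡⟨ cong₂ _*_ (op i l) (op l j) ⟩
    (v i * w l) * (v l * w j)  ≡⟨ swap (v i) (w l) (v l) (w j) ⟩
    (v i * w j) * (v l * w l)  ≡⟨ sym (cong₂ _*_ (op i j) (op l l)) ⟩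
    A i j * A l l              ∎

squareIs-unique : {a b : ℤ} {A : Mat k} → SquareIs a A → SquareIs b A → ∀ i j → A i j ≢ + 0 → a ≡ b
squareIs-unique {a = a} {b} {A} sqa sqb i j Aᵢⱼ≢0 =
  ℤ.*-cancelʳ-≡ a b (A i j) {{≢-nonZero Aᵢⱼ≢0}} (trans (sym (sqa i j)) (sqb i j))

outerProd⇒rank1 : {A : Mat k} {v w : Fin k → ℤ} → OuterProd A v w → (∀ j → w j ≢ + 0) →
  ∀ i j → A i j ≢ + 0 → HasRank A 1
outerProd⇒rank1 {A = A} {v} {w} op w≢0 i j Aᵢⱼ≢0 =
  ((λ _ → j) , column-injective , column-independent) , pairs-dependent
  where
  column-injective : Injective _≡_ _≡_ (λ (_ : Fin 1) → j)
  column-injective {fzero} {fzero} _ = refl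
  column-independent : LinIndep (λ (_ : Fin 1) → col A j)
  column-independent c Σ≡0 fzero with ℤ.i*j≡0⇒i≡0∨j≡0 (c fzero) (trans (sym (ℤ.+-identityʳ _)) (Σ≡0 i))
  ... | inj₁ c≡0   = c≡0
  ... | inj₂ Aᵢⱼ≡0 = contradiction Aᵢⱼ≡0 Aᵢⱼ≢0
  pairs-dependent : ∀ f → ¬ LinIndep (λ a → col A (f a))
  pairs-dependent f independent = w≢0 (f (fsuc fzero)) (independent coefficient vanishes fzero)
    where
    coefficient : Fin 2 → ℤ
    coefficient fzero    = w (f (fsuc fzero))
    coefficient (fsuc _) = - w (f fzero)
    cancel : ∀ a b x → b * (x * a) + (- a * (x * b) + + 0) ≡ + 0
    cancel = solve-∀
    vanishes : ∀ l → sumℤ (λ a → coefficient a * col A (f a) l) ≡ + 0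
    vanishes l = trans (cong₂ (λ s t → w (f (fsuc fzero)) * s + (- w (f fzero) * t + + 0))
                              (op l (f fzero)) (op l (f (fsuc fzero))))
                       (cancel (w (f fzero)) (w (f (fsuc fzero))) (v l))

-- The three conditions

positive∧squareIs⇒outerProd : {c : ℤ} {A : Mat (suc k)} → Positive A → SquareIs c A →
  Σ (Fin (suc k) → ℤ) λ v → Σ (Fin (suc k) → ℤ) λ w →
    (∀ i → + 0 < v i) × (∀ j → + 0 < w j) × OuterProd A v w
positive∧squareIs⇒outerProd {k} {c} {A} pos sq
  with positive⇒multiple-of-primitive (col A fzero) (λ i → pos i fzero)
... | g , 0<g , v , Aᵢ₀≡vᵢg , coefficient , Σcv≡1 = v , w , 0<v , 0<w , op
  where
  column-eigenvector : ∀ j → Eigenvector c A (col A j)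
  column-eigenvector = squareIs⇒eigenvector-col {c = c} {A} sq
  columns-proportional : ∀ i l j → A i j * A l fzero ≡ A l j * A i fzero
  columns-proportional i l j = eigenvectors-proportional {c = c} {A} {col A j} {col A fzero} pos
    (column-eigenvector j) (column-eigenvector fzero) (λ i → pos i fzero) i l
  proportional : ∀ i l j → A i j * v l ≡ A l j * v i
  proportional i l j = ℤ.*-cancelʳ-≡ (A i j * v l) (A l j * v i) g {{>-nonZero 0<g}} (begin
    A i j * v l * g      ≡⟨ ℤ.*-assoc (A i j) (v l) g ⟩
    A i j * (v l * g)    ≡⟨ cong (A i j *_) (sym (Aᵢ₀≡vᵢg l)) ⟩
    A i j * A l fzero    ≡⟨ columns-proportional i l j ⟩
    A l j * A i fzero    ≡⟨ cong (A l j *_) (Aᵢ₀≡vᵢg i) ⟩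
    A l j * (v i * g)    ≡⟨ sym (ℤ.*-assoc (A l j) (v i) g) ⟩
    A l j * v i * g      ∎)
  w : Fin (suc k) → ℤ
  w j = sumℤ (λ i → coefficient i * A i j)
  op : OuterProd A v w
  op = proportional-columns⇒outerProd A v coefficient proportional Σcv≡1
  0<v : ∀ i → + 0 < v i
  0<v i = ℤ.*-cancelʳ-<-nonNeg {+ 0} {v i} g {{nonNegative (ℤ.<⇒≤ 0<g)}}
            (subst (+ 0 <_) (Aᵢ₀≡vᵢg i) (pos i fzero))
  0<w : ∀ j → + 0 < w j
  0<w j = ℤ.*-cancelʳ-<-nonNeg {+ 0} {w j} (v fzero) {{nonNegative (ℤ.<⇒≤ (0<v fzero))}}
            (subst (+ 0 <_) (trans (op fzero j) (ℤ.*-comm (v fzero) (w j))) (pos fzero j))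

cond-ii⇒i : (n : ℕ) (A : Mat k) → Cond-ii n A → Cond-i n A
cond-ii⇒i n A (_ , trace≡n , v , w , _ , _ , op) =
  Equivalence.from (quadRel⇔squareIs n A)
    (subst (λ c → SquareIs c A) trace≡n (outerProd⇒squareIs-trace {v = v} {w} op))

cond-i⇒iii : (n : ℕ) (A : Mat k) → NonNegative A → Irreducible A → Cond-i n A → Cond-iii n A
cond-i⇒iii n A nonNeg irr q =
  q , squareIs∧irreducible⇒positive {c = + n} (Equivalence.to (quadRel⇔squareIs n A) q) nonNeg irr

cond-iii⇒ii : (n : ℕ) (A : Mat (suc k)) → Cond-iii n A → Cond-ii n A
cond-iii⇒ii n A (q , pos) =
  let sq = Equivalence.to (quadRel⇔squareIs n A) q
      (v , w , 0<v , 0<w , op) = positive∧squareIs⇒outerProd {c = + n} {A} pos sq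
      A₀₀≢0 = ≢-sym (ℤ.<⇒≢ (pos fzero fzero))
  in outerProd⇒rank1 {v = v} {w} op (λ j → ≢-sym (ℤ.<⇒≢ (0<w j))) fzero fzero A₀₀≢0 ,
     squareIs-unique {A = A} (outerProd⇒squareIs-trace {v = v} {w} op) sq fzero fzero A₀₀≢0 ,
     v , w , 0<v , 0<w , op

proposition4p1 : (n k : ℕ) → n ≥ 1 → (A : Mat (suc k)) → NonNegative A → Irreducible A →
    (Cond-i n A ⇔ Cond-ii n A) × (Cond-i n A ⇔ Cond-iii n A)
proposition4p1 n k _ A nonNeg irr =
  mk⇔ (cond-iii⇒ii n A ∘ cond-i⇒iii n A nonNeg irr) (cond-ii⇒i n A) ,
  mk⇔ (cond-i⇒iii n A nonNeg irr) proj₁
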